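{- (Structural contractions are not admissible.) There exist sequents $\Gamma\vdash F$ that are derivable in LBI without Cut but are not derivable in LBI without Cut when the contraction rule $Ctr\,L$ (from $\Gamma(\Gamma_1;\Gamma_1)\vdash H$ infer $\Gamma(\Gamma_1)\vdash H$) is restricted to instances in which $\Gamma_1$ is a single formula.
   Context: BI formulas: $F ::= p \mid \top \mid \bot \mid {}^*\!\top \mid F\wedge F \mid F\vee F \mid F\supset F \mid F * F \mid F \mathrel{ -\!*} F$, with $p$ ranging over propositional variables. Structures (bunches): $\Gamma ::= F \mid \Gamma;\Gamma \mid \Gamma,\Gamma$; ";" (additive) and "," (multiplicative) are each associative and commutative, neither distributes over the other, no empty structures. A context $\Gamma(-)$ is a structure with one hole. A sequent is $\Gamma\vdash F$. The calculus LBI has the rules: $id$: $F\vdash F$; $Cut$: from $\Gamma_1\vdash G$ and $\Gamma(G)\vdash H$ infer $\Gamma(\Gamma_1)\vdash H$; $\bot L$: $\Gamma(\bot)\vdash H$; $\top R$: $\Gamma\vdash\top$; ${}^*\!\top R$: ${}^*\!\top\vdash{}^*\!\top$; $\wedge L$: from $\Gamma(F;G)\vdash H$ infer $\Gamma(F\wedge G)\vdash H$; $\vee L$: from $\Gamma(F)\vdash H$ and $\Gamma(G)\vdash H$ infer $\Gamma(F\vee G)\vdash H$; $\supset L$: from $\Gamma_1\vdash F$ and $\Gamma(\Gamma_1;G)\vdash H$ infer $\Gamma(\Gamma_1;F\supset G)\vdash H$; $*L$: from $\Gamma(F,G)\vdash H$ infer $\Gamma(F*G)\vdash H$; $\mathrel{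 -\!*}L$: from $\Gamma_1\vdash F$ and $\Gamma(G)\vdash H$ infer $\Gamma(\Gamma_1,F\mathrel{ -\!*}G)\vdash H$; $\wedge R$: from $\Gamma\vdash F$ and $\Gamma\vdash G$ infer $\Gamma\vdash F\wedge G$; $\vee R$: from $\Gamma\vdash F_i$ infer $\Gamma\vdash F_1\vee F_2$; $\supset R$: from $\Gamma;F\vdash G$ infer $\Gamma\vdash F\supset G$; $*R$: from $\Gamma_1\vdash F$ and $\Gamma_2\vdash G$ infer $\Gamma_1,\Gamma_2\vdash F*G$; $\mathrel{ -\!*}R$: from $\Gamma,F\vdash G$ infer $\Gamma\vdash F\mathrel{ -\!*}G$; $Wk\,L$: from $\Gamma(\Gamma_1)\vdash H$ infer $\Gamma(\Gamma_1;\Gamma_2)\vdash H$; $Ctr\,L$: from $\Gamma(\Gamma_1;\Gamma_1)\vdash H$ infer $\Gamma(\Gamma_1)\vdash H$; and the bidirectional rules $EqAnt_1$ between $\Gamma(\Gamma_1;\top)\vdash H$ and $\Gamma(\Gamma_1)\vdash H$, and $EqAnt_2$ between $\Gamma(\Gamma_1,{}^*\!\top)\vdash H$ and $\Gamma(\Gamma_1)\vdash H$. -}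

module Defs where

open import Data.Nat using (ℕ)
open import Data.Unit using (⊤)
open import Data.Product using (Σ)
open import Relation.Binary.PropositionalEquality using (_≡_)

data Formula : Set where
  var  : ℕ → Formula
  ⊤ᶠ   : Formula
  ⊥ᶠ   : Formula
  *⊤   : Formula
  _∧_  : Formula → Formula → Formula
  _∨_  : Formula → Formula → Formula
  _⊃_  : Formula → Formula → Formula
  _✶_  : Formula → Formula → Formula
  _-✶_ : Formula → Formula → Formula

data Bunch : Set where
  fm  : Formula → Bunch
  _︔_ : Bunch → Bunch → Bunch
  _,,_ : Bunch → Bunch → Bunch

-- ";" and "," are associative and commutative: bunches are identified up to
-- the congruence generated by these laws (no distributivity, no units).
data _≈_ : Bunch → Bunch → Set where
  ≈-refl  : ∀ {Γ} → Γ ≈ Γ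
  ≈-sym   : ∀ {Γ Δ} → Γ ≈ Δ → Δ ≈ Γ
  ≈-trans : ∀ {Γ Δ Θ} → Γ ≈ Δ → Δ ≈ Θ → Γ ≈ Θ
  ︔-comm  : ∀ {Γ Δ} → (Γ ︔ Δ) ≈ (Δ ︔ Γ)
  ︔-assoc : ∀ {Γ Δ Θ} → ((Γ ︔ Δ) ︔ Θ) ≈ (Γ ︔ (Δ ︔ Θ))
  ,-comm  : ∀ {Γ Δ} → (Γ ,, Δ) ≈ (Δ ,, Γ)
  ,-assoc : ∀ {Γ Δ Θ} → ((Γ ,, Δ) ,, Θ) ≈ (Γ ,, (Δ ,, Θ))
  ︔-cong  : ∀ {Γ Γ' Δ Δ'} → Γ ≈ Γ' → Δ ≈ Δ' → (Γ ︔ Δ) ≈ (Γ' ︔ Δ')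
  ,-cong  : ∀ {Γ Γ' Δ Δ'} → Γ ≈ Γ' → Δ ≈ Δ' → (Γ ,, Δ) ≈ (Γ' ,, Δ')

data Ctx : Set where
  hole : Ctx
  _︔ˡ_ : Ctx → Bunch → Ctx
  _︔ʳ_ : Bunch → Ctx → Ctx
  _,ˡ_ : Ctx → Bunch → Ctx
  _,ʳ_ : Bunch → Ctx → Ctx

_[_] : Ctx → Bunch → Bunch
hole     [ Δ ] = Δ
(C ︔ˡ Θ) [ Δ ] = (C [ Δ ]) ︔ Θ
(Θ ︔ʳ C) [ Δ ] = Θ ︔ (C [ Δ ])
(C ,ˡ Θ) [ Δ ] = (C [ Δ ]) ,, Θ
(Θ ,ʳ C) [ Δ ] = Θ ,, (C [ Δ ])

data CtrMode : Set where
  unrestricted : CtrMode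
  formulaOnly  : CtrMode

CtrAllowed : CtrMode → Bunch → Set
CtrAllowed unrestricted Γ₁ = ⊤
CtrAllowed formulaOnly  Γ₁ = Σ Formula (λ F → Γ₁ ≡ fm F)

-- Cut-free LBI derivability, parametrised by the allowed contractions.
-- Bunches are taken up to ≈ (rule `equiv`).
data _⊢[_]_ : Bunch → CtrMode → Formula → Set where
  equiv : ∀ {m Γ Γ' H} → Γ ≈ Γ' → Γ' ⊢[ m ] H → Γ ⊢[ m ] H
  id    : ∀ {m F} → fm F ⊢[ m ] F
  ⊥L    : ∀ {m H} (C : Ctx) → (C [ fm ⊥ᶠ ]) ⊢[ m ] H
  ⊤R    : ∀ {m Γ} → Γ ⊢[ m ] ⊤ᶠ
  *⊤R   : ∀ {m} → fm *⊤ ⊢[ m ] *⊤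
  ∧L    : ∀ {m F G H} (C : Ctx) → (C [ fm F ︔ fm G ]) ⊢[ m ] H → (C [ fm (F ∧ G) ]) ⊢[ m ] H
  ∨L    : ∀ {m F G H} (C : Ctx) → (C [ fm F ]) ⊢[ m ] H → (C [ fm G ]) ⊢[ m ] H
          → (C [ fm (F ∨ G) ]) ⊢[ m ] H
  ⊃L    : ∀ {m Γ₁ F G H} (C : Ctx) → Γ₁ ⊢[ m ] F → (C [ Γ₁ ︔ fm G ]) ⊢[ m ] H
          → (C [ Γ₁ ︔ fm (F ⊃ G) ]) ⊢[ m ] H
  ✶L    : ∀ {m F G H} (C : Ctx) → (C [ fm F ,, fm G ]) ⊢[ m ] H → (C [ fm (F ✶ G) ]) ⊢[ m ] H
  -✶L   : ∀ {m Γ₁ F G H} (C : Ctx) → Γ₁ ⊢[ m ] F → (C [ fm G ]) ⊢[ m ] H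
          → (C [ Γ₁ ,, fm (F -✶ G) ]) ⊢[ m ] H
  ∧R    : ∀ {m Γ F G} → Γ ⊢[ m ] F → Γ ⊢[ m ] G → Γ ⊢[ m ] (F ∧ G)
  ∨R₁   : ∀ {m Γ F G} → Γ ⊢[ m ] F → Γ ⊢[ m ] (F ∨ G)
  ∨R₂   : ∀ {m Γ F G} → Γ ⊢[ m ] G → Γ ⊢[ m ] (F ∨ G)
  ⊃R    : ∀ {m Γ F G} → (Γ ︔ fm F) ⊢[ m ] G → Γ ⊢[ m ] (F ⊃ G)
  ✶R    : ∀ {m Γ₁ Γ₂ F G} → Γ₁ ⊢[ m ] F → Γ₂ ⊢[ m ] G → (Γ₁ ,, Γ₂) ⊢[ m ] (F ✶ G)
  -✶R   : ∀ {m Γ F G} → (Γ ,, fm F) ⊢[ m ] G → Γ ⊢[ m ] (F -✶ G)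
  WkL   : ∀ {m Γ₁ Γ₂ H} (C : Ctx) → (C [ Γ₁ ]) ⊢[ m ] H → (C [ Γ₁ ︔ Γ₂ ]) ⊢[ m ] H
  CtrL  : ∀ {m Γ₁ H} (C : Ctx) → CtrAllowed m Γ₁ → (C [ Γ₁ ︔ Γ₁ ]) ⊢[ m ] H
          → (C [ Γ₁ ]) ⊢[ m ] H
  EqAnt₁↓ : ∀ {m Γ₁ H} (C : Ctx) → (C [ Γ₁ ︔ fm ⊤ᶠ ]) ⊢[ m ] H → (C [ Γ₁ ]) ⊢[ m ] H
  EqAnt₁↑ : ∀ {m Γ₁ H} (C : Ctx) → (C [ Γ₁ ]) ⊢[ m ] H → (C [ Γ₁ ︔ fm ⊤ᶠ ]) ⊢[ m ] H
  EqAnt₂↓ : ∀ {m Γ₁ H} (C : Ctx) → (C [ Γ₁ ,, fm *⊤ ]) ⊢[ m ] H → (C [ Γ₁ ]) ⊢[ m ] H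
  EqAnt₂↑ : ∀ {m Γ₁ H} (C : Ctx) → (C [ Γ₁ ]) ⊢[ m ] H → (C [ Γ₁ ,, fm *⊤ ]) ⊢[ m ] H

module Submission where

-- The witness is the sequent  p , (p -* a ; p -* (a ⊃ b)) ⊢ b.  With
-- unrestricted contraction it is derivable: duplicate the whole bunch, feed
-- p to p -* a in one copy and to p -* (a ⊃ b) in the other, and combine a
-- with a ⊃ b.  With contraction on single formulas only, p can never be
-- used twice.
--
-- The negative half is a soundness argument for a finite model.  A bunch is
-- interpreted by seven bits recording which of p, a, b, a ⊃ b, p -* a,
-- p -* (a ⊃ b), *⊤ it "yields"; ";" and "," become two commutative,
-- associative, monotone operations on these bit-vectors.  The additive
-- composition produces b only when a and a ⊃ b come from DIFFERENT sides,
-- so it is idempotent on single formulas but not on arbitrary bunches.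
-- Every rule of the formula-contraction calculus preserves "the bunch
-- yields the succedent" for sequents built from subformulas of the witness
-- (cut-freeness gives the subformula property), yet our bunch does not
-- yield b.

open import Defs
open import Data.Bool using (Bool; true; false; T)
  renaming (_∧_ to _∧ᵇ_; _∨_ to _∨ᵇ_)
open import Data.Bool.Properties
  using (∨-comm; ∨-assoc; ∧-comm; ∧-assoc; ∨-identityʳ; ∧-identityʳ; T-∨; T-∧)
open import Data.Bool.Solver using (module ∨-∧-Solver)
open ∨-∧-Solver using (solve; _:=_; _:+_; _:*_; con)
open import Data.Nat using (ℕ)
open import Data.Product using (Σ; _×_; _,_; swap; assocʳ′; assocˡ′)
open import Data.Product.Function.NonDependent.Propositional using (_×-⇔_)
open import Data.Sum using (inj₁; inj₂)
open import Data.Unit using (tt) renaming (⊤ to Unit)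
open import Function.Bundles using (_⇔_; mk⇔; Equivalence)
open import Function.Properties.Equivalence using (⇔-isEquivalence)
open import Level using (0ℓ)
open import Relation.Binary.Core using (Rel; _Preserves₂_⟶_⟶_)
open import Relation.Binary.Structures using (IsEquivalence)
open import Relation.Binary.PropositionalEquality
  using (_≡_; refl; sym; trans; cong; cong₂; subst)
open import Relation.Nullary using (¬_)

module ⇔ = IsEquivalence (⇔-isEquivalence {ℓ = 0ℓ})

module EveryFormula (R : Formula → Set) where

  Every : Bunch → Set
  Every (fm F)  = R F
  Every (Γ ︔ Δ) = Every Γ × Every Δ
  Every (Γ ,, Δ) = Every Γ × Every Δ

  EveryCtx : Ctx → Set
  EveryCtx hole     = Unit
  EveryCtx (C ︔ˡ Θ) = EveryCtx C × Every Θ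
  EveryCtx (Θ ︔ʳ C) = Every Θ × EveryCtx C
  EveryCtx (C ,ˡ Θ) = EveryCtx C × Every Θ
  EveryCtx (Θ ,ʳ C) = Every Θ × EveryCtx C

  splitEvery : ∀ C Δ → Every (C [ Δ ]) → EveryCtx C × Every Δ
  splitEvery hole     Δ eΔ = tt , eΔ
  splitEvery (C ︔ˡ Θ) Δ (eC , eΘ) with splitEvery C Δ eC
  ... | eC′ , eΔ = (eC′ , eΘ) , eΔ
  splitEvery (Θ ︔ʳ C) Δ (eΘ , eC) with splitEvery C Δ eC
  ... | eC′ , eΔ = (eΘ , eC′) , eΔ
  splitEvery (C ,ˡ Θ) Δ (eC , eΘ) with splitEvery C Δ eC
  ... | eC′ , eΔ = (eC′ , eΘ) , eΔ
  splitEvery (Θ ,ʳ C) Δ (eΘ , eC) with splitEvery C Δ eC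
  ... | eC′ , eΔ = (eΘ , eC′) , eΔ

  plugEvery : ∀ C Δ → EveryCtx C → Every Δ → Every (C [ Δ ])
  plugEvery hole     Δ tt        eΔ = eΔ
  plugEvery (C ︔ˡ Θ) Δ (eC , eΘ) eΔ = plugEvery C Δ eC eΔ , eΘ
  plugEvery (Θ ︔ʳ C) Δ (eΘ , eC) eΔ = eΘ , plugEvery C Δ eC eΔ
  plugEvery (C ,ˡ Θ) Δ (eC , eΘ) eΔ = plugEvery C Δ eC eΔ , eΘ
  plugEvery (Θ ,ʳ C) Δ (eΘ , eC) eΔ = eΘ , plugEvery C Δ eC eΔ

  Every-resp-≈ : ∀ {Γ Δ} → Γ ≈ Δ → Every Γ ⇔ Every Δ
  Every-resp-≈ ≈-refl        = ⇔.refl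
  Every-resp-≈ (≈-sym e)     = ⇔.sym (Every-resp-≈ e)
  Every-resp-≈ (≈-trans e f) = ⇔.trans (Every-resp-≈ e) (Every-resp-≈ f)
  Every-resp-≈ ︔-comm        = mk⇔ swap swap
  Every-resp-≈ ︔-assoc       = mk⇔ assocʳ′ assocˡ′
  Every-resp-≈ ,-comm        = mk⇔ swap swap
  Every-resp-≈ ,-assoc       = mk⇔ assocʳ′ assocˡ′
  Every-resp-≈ (︔-cong e f)  = Every-resp-≈ e ×-⇔ Every-resp-≈ f
  Every-resp-≈ (,-cong e f)  = Every-resp-≈ e ×-⇔ Every-resp-≈ f

module Interpretation {V : Set} (_⊗_ _⊙_ : V → V → V) (atom : Formula → V) where

  ⟦_⟧ : Bunch → V
  ⟦ fm F ⟧  = atom F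
  ⟦ Γ ︔ Δ ⟧ = ⟦ Γ ⟧ ⊗ ⟦ Δ ⟧
  ⟦ Γ ,, Δ ⟧ = ⟦ Γ ⟧ ⊙ ⟦ Δ ⟧

  ⟦_⟧ᶜ : Ctx → V → V
  ⟦ hole ⟧ᶜ     x = x
  ⟦ C ︔ˡ Θ ⟧ᶜ x = ⟦ C ⟧ᶜ x ⊗ ⟦ Θ ⟧
  ⟦ Θ ︔ʳ C ⟧ᶜ x = ⟦ Θ ⟧ ⊗ ⟦ C ⟧ᶜ x
  ⟦ C ,ˡ Θ ⟧ᶜ x = ⟦ C ⟧ᶜ x ⊙ ⟦ Θ ⟧
  ⟦ Θ ,ʳ C ⟧ᶜ x = ⟦ Θ ⟧ ⊙ ⟦ C ⟧ᶜ x

  ⟦plug⟧ : ∀ C Δ → ⟦ C [ Δ ] ⟧ ≡ ⟦ C ⟧ᶜ ⟦ Δ ⟧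
  ⟦plug⟧ hole     Δ = refl
  ⟦plug⟧ (C ︔ˡ Θ) Δ = cong (_⊗ ⟦ Θ ⟧) (⟦plug⟧ C Δ)
  ⟦plug⟧ (Θ ︔ʳ C) Δ = cong (⟦ Θ ⟧ ⊗_) (⟦plug⟧ C Δ)
  ⟦plug⟧ (C ,ˡ Θ) Δ = cong (_⊙ ⟦ Θ ⟧) (⟦plug⟧ C Δ)
  ⟦plug⟧ (Θ ,ʳ C) Δ = cong (⟦ Θ ⟧ ⊙_) (⟦plug⟧ C Δ)

  open import Algebra.Definitions {A = V} _≡_ using (Commutative; Associative)

  module Invariance (⊗-comm : Commutative _⊗_) (⊗-assoc : Associative _⊗_)
           (⊙-comm : Commutative _⊙_) (⊙-assoc : Associative _⊙_) where

    ⟦⟧-resp-≈ : ∀ {Γ Δ} → Γ ≈ Δ → ⟦ Γ ⟧ ≡ ⟦ Δ ⟧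
    ⟦⟧-resp-≈ ≈-refl        = refl
    ⟦⟧-resp-≈ (≈-sym e)     = sym (⟦⟧-resp-≈ e)
    ⟦⟧-resp-≈ (≈-trans e f) = trans (⟦⟧-resp-≈ e) (⟦⟧-resp-≈ f)
    ⟦⟧-resp-≈ (︔-comm {Γ} {Δ})       = ⊗-comm ⟦ Γ ⟧ ⟦ Δ ⟧
    ⟦⟧-resp-≈ (︔-assoc {Γ} {Δ} {Θ}) = ⊗-assoc ⟦ Γ ⟧ ⟦ Δ ⟧ ⟦ Θ ⟧
    ⟦⟧-resp-≈ (,-comm {Γ} {Δ})       = ⊙-comm ⟦ Γ ⟧ ⟦ Δ ⟧
    ⟦⟧-resp-≈ (,-assoc {Γ} {Δ} {Θ}) = ⊙-assoc ⟦ Γ ⟧ ⟦ Δ ⟧ ⟦ Θ ⟧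
    ⟦⟧-resp-≈ (︔-cong e f)  = cong₂ _⊗_ (⟦⟧-resp-≈ e) (⟦⟧-resp-≈ f)
    ⟦⟧-resp-≈ (,-cong e f)  = cong₂ _⊙_ (⟦⟧-resp-≈ e) (⟦⟧-resp-≈ f)

  module Monotonicity (_≤_ : Rel V 0ℓ) (≤-refl : ∀ {x} → x ≤ x)
           (⊗-mono : _⊗_ Preserves₂ _≤_ ⟶ _≤_ ⟶ _≤_)
           (⊙-mono : _⊙_ Preserves₂ _≤_ ⟶ _≤_ ⟶ _≤_) where

    ⟦⟧ᶜ-mono : ∀ C {x y} → x ≤ y → ⟦ C ⟧ᶜ x ≤ ⟦ C ⟧ᶜ y
    ⟦⟧ᶜ-mono hole     x≤y = x≤y
    ⟦⟧ᶜ-mono (C ︔ˡ Θ) x≤y = ⊗-mono (⟦⟧ᶜ-mono C x≤y) ≤-refl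
    ⟦⟧ᶜ-mono (Θ ︔ʳ C) x≤y = ⊗-mono ≤-refl (⟦⟧ᶜ-mono C x≤y)
    ⟦⟧ᶜ-mono (C ,ˡ Θ) x≤y = ⊙-mono (⟦⟧ᶜ-mono C x≤y) ≤-refl
    ⟦⟧ᶜ-mono (Θ ,ʳ C) x≤y = ⊙-mono ≤-refl (⟦⟧ᶜ-mono C x≤y)

-- The two sides of a composition interact in only one way: "x on one side
-- and y on the other".  The bit-level operations of the model are built
-- from this over any carrier with a sum and a product, so that they can be
-- read both as boolean functions and as polynomials for the solver.
module Combinators {S : Set} (_+_ _*_ : S → S → S) where

  across : S → S → S → S → S
  across x₁ x₂ y₁ y₂ = (x₁ * y₂) + (y₁ * x₂)

  -- b-bit of an additive composition: b from either side, or modus ponens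
  -- with a on one side and a ⊃ b on the other.
  withMP : S → S → S → S → S → S → S
  withMP b₁ b₂ a₁ a₂ i₁ i₂ = (b₁ + b₂) + across a₁ a₂ i₁ i₂

  -- bit x of a multiplicative composition, where x is the conclusion of a
  -- wand w = p -* x: x survives next to a unit u, or w is applied to a p
  -- coming from the other side.
  withWand : S → S → S → S → S → S → S → S → S
  withWand x₁ x₂ u₁ u₂ p₁ p₂ w₁ w₂ = across x₁ x₂ u₁ u₂ + across p₁ p₂ w₁ w₂

  module Monotone (_≤_ : Rel S 0ℓ) (+-mono : _+_ Preserves₂ _≤_ ⟶ _≤_ ⟶ _≤_)
           (*-mono : _*_ Preserves₂ _≤_ ⟶ _≤_ ⟶ _≤_) where

    private variable
      x₁ x₁′ x₂ x₂′ y₁ y₁′ y₂ y₂′ : S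
      z₁ z₁′ z₂ z₂′ t₁ t₁′ t₂ t₂′ : S

    across-mono : x₁ ≤ x₁′ → x₂ ≤ x₂′ → y₁ ≤ y₁′ → y₂ ≤ y₂′
                → across x₁ x₂ y₁ y₂ ≤ across x₁′ x₂′ y₁′ y₂′
    across-mono x₁≤ x₂≤ y₁≤ y₂≤ = +-mono (*-mono x₁≤ y₂≤) (*-mono y₁≤ x₂≤)

    withMP-mono : x₁ ≤ x₁′ → x₂ ≤ x₂′ → y₁ ≤ y₁′ → y₂ ≤ y₂′
                → z₁ ≤ z₁′ → z₂ ≤ z₂′
                → withMP x₁ x₂ y₁ y₂ z₁ z₂ ≤ withMP x₁′ x₂′ y₁′ y₂′ z₁′ z₂′
    withMP-mono x₁≤ x₂≤ y₁≤ y₂≤ z₁≤ z₂≤ =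
      +-mono (+-mono x₁≤ x₂≤) (across-mono y₁≤ y₂≤ z₁≤ z₂≤)

    withWand-mono : x₁ ≤ x₁′ → x₂ ≤ x₂′ → y₁ ≤ y₁′ → y₂ ≤ y₂′
                  → z₁ ≤ z₁′ → z₂ ≤ z₂′ → t₁ ≤ t₁′ → t₂ ≤ t₂′
                  → withWand x₁ x₂ y₁ y₂ z₁ z₂ t₁ t₂
                    ≤ withWand x₁′ x₂′ y₁′ y₂′ z₁′ z₂′ t₁′ t₂′
    withWand-mono x₁≤ x₂≤ y₁≤ y₂≤ z₁≤ z₂≤ t₁≤ t₂≤ =
      +-mono (across-mono x₁≤ x₂≤ y₁≤ y₂≤) (across-mono z₁≤ z₂≤ t₁≤ t₂≤)

open Combinators _∨ᵇ_ _∧ᵇ_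
module Poly {n : ℕ} = Combinators (_:+_ {n}) _:*_

across-comm : ∀ x₁ x₂ y₁ y₂ → across x₁ x₂ y₁ y₂ ≡ across x₂ x₁ y₂ y₁
across-comm = solve 4 (λ x₁ x₂ y₁ y₂ →
  Poly.across x₁ x₂ y₁ y₂ := Poly.across x₂ x₁ y₂ y₁) refl

across-assoc : ∀ x₁ x₂ x₃ u₁ u₂ u₃ →
  across (across x₁ x₂ u₁ u₂) x₃ (u₁ ∧ᵇ u₂) u₃
  ≡ across x₁ (across x₂ x₃ u₂ u₃) u₁ (u₂ ∧ᵇ u₃)
across-assoc = solve 6 (λ x₁ x₂ x₃ u₁ u₂ u₃ →
  Poly.across (Poly.across x₁ x₂ u₁ u₂) x₃ (u₁ :* u₂) u₃
  := Poly.across x₁ (Poly.across x₂ x₃ u₂ u₃) u₁ (u₂ :* u₃)) refl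

withMP-comm : ∀ b₁ b₂ a₁ a₂ i₁ i₂ →
  withMP b₁ b₂ a₁ a₂ i₁ i₂ ≡ withMP b₂ b₁ a₂ a₁ i₂ i₁
withMP-comm = solve 6 (λ b₁ b₂ a₁ a₂ i₁ i₂ →
  Poly.withMP b₁ b₂ a₁ a₂ i₁ i₂ := Poly.withMP b₂ b₁ a₂ a₁ i₂ i₁) refl

withMP-assoc : ∀ b₁ b₂ b₃ a₁ a₂ a₃ i₁ i₂ i₃ →
  withMP (withMP b₁ b₂ a₁ a₂ i₁ i₂) b₃ (a₁ ∨ᵇ a₂) a₃ (i₁ ∨ᵇ i₂) i₃
  ≡ withMP b₁ (withMP b₂ b₃ a₂ a₃ i₂ i₃) a₁ (a₂ ∨ᵇ a₃) i₁ (i₂ ∨ᵇ i₃)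
withMP-assoc = solve 9 (λ b₁ b₂ b₃ a₁ a₂ a₃ i₁ i₂ i₃ →
  Poly.withMP (Poly.withMP b₁ b₂ a₁ a₂ i₁ i₂) b₃ (a₁ :+ a₂) a₃ (i₁ :+ i₂) i₃
  := Poly.withMP b₁ (Poly.withMP b₂ b₃ a₂ a₃ i₂ i₃) a₁ (a₂ :+ a₃) i₁ (i₂ :+ i₃))
  refl

withWand-comm : ∀ x₁ x₂ u₁ u₂ p₁ p₂ w₁ w₂ →
  withWand x₁ x₂ u₁ u₂ p₁ p₂ w₁ w₂ ≡ withWand x₂ x₁ u₂ u₁ p₂ p₁ w₂ w₁
withWand-comm = solve 8 (λ x₁ x₂ u₁ u₂ p₁ p₂ w₁ w₂ →
  Poly.withWand x₁ x₂ u₁ u₂ p₁ p₂ w₁ w₂ := Poly.withWand x₂ x₁ u₂ u₁ p₂ p₁ w₂ w₁)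
  refl

withWand-assoc : ∀ x₁ x₂ x₃ u₁ u₂ u₃ p₁ p₂ p₃ w₁ w₂ w₃ →
  withWand (withWand x₁ x₂ u₁ u₂ p₁ p₂ w₁ w₂) x₃ (u₁ ∧ᵇ u₂) u₃
           (across p₁ p₂ u₁ u₂) p₃ (across w₁ w₂ u₁ u₂) w₃
  ≡ withWand x₁ (withWand x₂ x₃ u₂ u₃ p₂ p₃ w₂ w₃) u₁ (u₂ ∧ᵇ u₃)
             p₁ (across p₂ p₃ u₂ u₃) w₁ (across w₂ w₃ u₂ u₃)
withWand-assoc = solve 12 (λ x₁ x₂ x₃ u₁ u₂ u₃ p₁ p₂ p₃ w₁ w₂ w₃ →
  Poly.withWand (Poly.withWand x₁ x₂ u₁ u₂ p₁ p₂ w₁ w₂) x₃ (u₁ :* u₂) u₃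
                (Poly.across p₁ p₂ u₁ u₂) p₃ (Poly.across w₁ w₂ u₁ u₂) w₃
  := Poly.withWand x₁ (Poly.withWand x₂ x₃ u₂ u₃ p₂ p₃ w₂ w₃) u₁ (u₂ :* u₃)
                   p₁ (Poly.across p₂ p₃ u₂ u₃) w₁ (Poly.across w₂ w₃ u₂ u₃))
  refl

withMP-identityʳ : ∀ b a i → withMP b false a false i false ≡ b
withMP-identityʳ = solve 3 (λ b a i →
  Poly.withMP b (con false) a (con false) i (con false) := b) refl

across-identityʳ : ∀ x u → across x false u true ≡ x
across-identityʳ = solve 2 (λ x u → Poly.across x (con false) u (con true) := x) refl

across-zeroʳ : ∀ x u → across x false u false ≡ false
across-zeroʳ = solve 2 (λ x u → Poly.across x (con false) u (con false) := con false) refl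

withWand-identityʳ : ∀ x u p w → withWand x false u true p false w false ≡ x
withWand-identityʳ = solve 4 (λ x u p w →
  Poly.withWand x (con false) u (con true) p (con false) w (con false) := x) refl

withMP-major : ∀ b a i → withMP b false a false i true ≡ b ∨ᵇ a
withMP-major = solve 3 (λ b a i →
  Poly.withMP b (con false) a (con false) i (con true) := b :+ a) refl

withMP-minor : ∀ b a i → withMP b false a true i false ≡ i ∨ᵇ b
withMP-minor = solve 3 (λ b a i →
  Poly.withMP b (con false) a (con true) i (con false) := i :+ b) refl

withWand-major : ∀ x u p w → withWand x false u false p false w true ≡ p
withWand-major = solve 4 (λ x u p w →
  Poly.withWand x (con false) u (con false) p (con false) w (con true) := p) refl

withWand-minor : ∀ x u p w → withWand x false u false p true w false ≡ w
withWand-minor = solve 4 (λ x u p w →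
  Poly.withWand x (con false) u (con false) p (con true) w (con false) := w) refl

pattern P   = var 0
pattern A   = var 1
pattern B   = var 2
pattern A⊃B = var 1 ⊃ var 2
pattern W₁  = var 0 -✶ var 1
pattern W₂  = var 0 -✶ (var 1 ⊃ var 2)

-- The relevant formulas: subformulas of the witness, plus the two units that
-- EqAnt₁ and EqAnt₂ may insert.
data Relevant : Formula → Set where
  rel-p   : Relevant P
  rel-a   : Relevant A
  rel-b   : Relevant B
  rel-a⊃b : Relevant A⊃B
  rel-w₁  : Relevant W₁
  rel-w₂  : Relevant W₂
  rel-⊤   : Relevant ⊤ᶠ
  rel-*⊤  : Relevant *⊤

-- Which relevant formulas (other than ⊤) a bunch yields.
record Val : Set where
  field has-p has-a has-b has-a⊃b has-w₁ has-w₂ has-*⊤ : Bool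
open Val

Val-≡ : ∀ {v w} → has-p v ≡ has-p w → has-a v ≡ has-a w → has-b v ≡ has-b w
      → has-a⊃b v ≡ has-a⊃b w → has-w₁ v ≡ has-w₁ w → has-w₂ v ≡ has-w₂ w
      → has-*⊤ v ≡ has-*⊤ w → v ≡ w
Val-≡ refl refl refl refl refl refl refl = refl

nothing : Val
nothing = record { has-p = false ; has-a = false ; has-b = false ; has-a⊃b = false
                 ; has-w₁ = false ; has-w₂ = false ; has-*⊤ = false }

-- A single formula yields itself.  Irrelevant formulas never occur below.
atom : Formula → Val
atom P   = record nothing { has-p = true }
atom A   = record nothing { has-a = true }
atom B   = record nothing { has-b = true }
atom A⊃B = record nothing { has-a⊃b = true }
atom W₁  = record nothing { has-w₁ = true }
atom W₂  = record nothing { has-w₂ = true }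
atom *⊤  = record nothing { has-*⊤ = true }
atom _   = nothing

-- ";": everything from both sides, and b by modus ponens across the sides.
infixl 7 _⊗_ _⊙_
infix 4 _≼_

_⊗_ : Val → Val → Val
v ⊗ w = record
  { has-p   = has-p v ∨ᵇ has-p w
  ; has-a   = has-a v ∨ᵇ has-a w
  ; has-b   = withMP (has-b v) (has-b w) (has-a v) (has-a w) (has-a⊃b v) (has-a⊃b w)
  ; has-a⊃b = has-a⊃b v ∨ᵇ has-a⊃b w
  ; has-w₁  = has-w₁ v ∨ᵇ has-w₁ w
  ; has-w₂  = has-w₂ v ∨ᵇ has-w₂ w
  ; has-*⊤  = has-*⊤ v ∨ᵇ has-*⊤ w
  }

-- ",": a formula survives only next to a side yielding *⊤, and a (resp.
-- a ⊃ b) is also produced by applying p -* a (resp. p -* (a ⊃ b)) to p.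
_⊙_ : Val → Val → Val
v ⊙ w = record
  { has-p   = across (has-p v) (has-p w) (has-*⊤ v) (has-*⊤ w)
  ; has-a   = withWand (has-a v) (has-a w) (has-*⊤ v) (has-*⊤ w)
                       (has-p v) (has-p w) (has-w₁ v) (has-w₁ w)
  ; has-b   = across (has-b v) (has-b w) (has-*⊤ v) (has-*⊤ w)
  ; has-a⊃b = withWand (has-a⊃b v) (has-a⊃b w) (has-*⊤ v) (has-*⊤ w)
                       (has-p v) (has-p w) (has-w₂ v) (has-w₂ w)
  ; has-w₁  = across (has-w₁ v) (has-w₁ w) (has-*⊤ v) (has-*⊤ w)
  ; has-w₂  = across (has-w₂ v) (has-w₂ w) (has-*⊤ v) (has-*⊤ w)
  ; has-*⊤  = has-*⊤ v ∧ᵇ has-*⊤ w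
  }

⊗-comm : ∀ v w → v ⊗ w ≡ w ⊗ v
⊗-comm v w = Val-≡ (∨-comm (has-p v) (has-p w)) (∨-comm (has-a v) (has-a w))
  (withMP-comm (has-b v) (has-b w) (has-a v) (has-a w) (has-a⊃b v) (has-a⊃b w))
  (∨-comm (has-a⊃b v) (has-a⊃b w)) (∨-comm (has-w₁ v) (has-w₁ w))
  (∨-comm (has-w₂ v) (has-w₂ w)) (∨-comm (has-*⊤ v) (has-*⊤ w))

⊗-assoc : ∀ u v w → (u ⊗ v) ⊗ w ≡ u ⊗ (v ⊗ w)
⊗-assoc u v w = Val-≡ (∨-assoc (has-p u) (has-p v) (has-p w))
  (∨-assoc (has-a u) (has-a v) (has-a w))
  (withMP-assoc (has-b u) (has-b v) (has-b w) (has-a u) (has-a v) (has-a w)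
                (has-a⊃b u) (has-a⊃b v) (has-a⊃b w))
  (∨-assoc (has-a⊃b u) (has-a⊃b v) (has-a⊃b w)) (∨-assoc (has-w₁ u) (has-w₁ v) (has-w₁ w))
  (∨-assoc (has-w₂ u) (has-w₂ v) (has-w₂ w)) (∨-assoc (has-*⊤ u) (has-*⊤ v) (has-*⊤ w))

⊙-comm : ∀ v w → v ⊙ w ≡ w ⊙ v
⊙-comm v w = Val-≡ (keep has-p) (fire has-a has-w₁) (keep has-b) (fire has-a⊃b has-w₂)
                   (keep has-w₁) (keep has-w₂) (∧-comm e₁ e₂)
  where
  e₁ e₂ : Bool
  e₁ = has-*⊤ v
  e₂ = has-*⊤ w

  keep : ∀ (x : Val → Bool) → across (x v) (x w) e₁ e₂ ≡ across (x w) (x v) e₂ e₁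
  keep x = across-comm (x v) (x w) e₁ e₂

  fire : ∀ (x wand : Val → Bool) →
    withWand (x v) (x w) e₁ e₂ (has-p v) (has-p w) (wand v) (wand w)
    ≡ withWand (x w) (x v) e₂ e₁ (has-p w) (has-p v) (wand w) (wand v)
  fire x wand = withWand-comm (x v) (x w) e₁ e₂ (has-p v) (has-p w) (wand v) (wand w)

⊙-assoc : ∀ u v w → (u ⊙ v) ⊙ w ≡ u ⊙ (v ⊙ w)
⊙-assoc u v w = Val-≡ (keep has-p) (fire has-a has-w₁) (keep has-b) (fire has-a⊃b has-w₂)
                      (keep has-w₁) (keep has-w₂) (∧-assoc e₁ e₂ e₃)
  where
  e₁ e₂ e₃ : Bool
  e₁ = has-*⊤ u
  e₂ = has-*⊤ v
  e₃ = has-*⊤ w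

  keep : ∀ (x : Val → Bool) →
    across (across (x u) (x v) e₁ e₂) (x w) (e₁ ∧ᵇ e₂) e₃
    ≡ across (x u) (across (x v) (x w) e₂ e₃) e₁ (e₂ ∧ᵇ e₃)
  keep x = across-assoc (x u) (x v) (x w) e₁ e₂ e₃

  fire : ∀ (x wand : Val → Bool) →
    withWand (withWand (x u) (x v) e₁ e₂ (has-p u) (has-p v) (wand u) (wand v))
             (x w) (e₁ ∧ᵇ e₂) e₃ (across (has-p u) (has-p v) e₁ e₂) (has-p w)
             (across (wand u) (wand v) e₁ e₂) (wand w)
    ≡ withWand (x u) (withWand (x v) (x w) e₂ e₃ (has-p v) (has-p w) (wand v) (wand w))
               e₁ (e₂ ∧ᵇ e₃) (has-p u) (across (has-p v) (has-p w) e₂ e₃)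
               (wand u) (across (wand v) (wand w) e₂ e₃)
  fire x wand = withWand-assoc (x u) (x v) (x w) e₁ e₂ e₃
                               (has-p u) (has-p v) (has-p w) (wand u) (wand v) (wand w)

⊗-identityʳ : ∀ v → v ⊗ atom ⊤ᶠ ≡ v
⊗-identityʳ v = Val-≡ (∨-identityʳ (has-p v)) (∨-identityʳ (has-a v))
  (withMP-identityʳ (has-b v) (has-a v) (has-a⊃b v)) (∨-identityʳ (has-a⊃b v))
  (∨-identityʳ (has-w₁ v)) (∨-identityʳ (has-w₂ v)) (∨-identityʳ (has-*⊤ v))

⊙-identityʳ : ∀ v → v ⊙ atom *⊤ ≡ v
⊙-identityʳ v = Val-≡ (across-identityʳ (has-p v) (has-*⊤ v))
  (withWand-identityʳ (has-a v) (has-*⊤ v) (has-p v) (has-w₁ v))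
  (across-identityʳ (has-b v) (has-*⊤ v))
  (withWand-identityʳ (has-a⊃b v) (has-*⊤ v) (has-p v) (has-w₂ v))
  (across-identityʳ (has-w₁ v) (has-*⊤ v)) (across-identityʳ (has-w₂ v) (has-*⊤ v))
  (∧-identityʳ (has-*⊤ v))

-- Contraction of a single relevant formula is invisible to the model.  (It is
-- not so for bunches: the value of Γ₀ ; Γ₀ has b, that of Γ₀ does not.)
atom-idempotent : ∀ {F} → Relevant F → atom F ⊗ atom F ≡ atom F
atom-idempotent rel-p   = refl
atom-idempotent rel-a   = refl
atom-idempotent rel-b   = refl
atom-idempotent rel-a⊃b = refl
atom-idempotent rel-w₁  = refl
atom-idempotent rel-w₂  = refl
atom-idempotent rel-⊤   = refl
atom-idempotent rel-*⊤  = refl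

-- Bitwise implication, the order in which weakening and the left rules move.
_⇒ᵇ_ : Rel Bool 0ℓ
x ⇒ᵇ y = T x → T y

T-∨ˡ : ∀ {x y} → T x → T (x ∨ᵇ y)
T-∨ˡ {x} {y} tx = Equivalence.from (T-∨ {x} {y}) (inj₁ tx)

T-∨ʳ : ∀ {x y} → T y → T (x ∨ᵇ y)
T-∨ʳ {x} {y} ty = Equivalence.from (T-∨ {x} {y}) (inj₂ ty)

∨-mono : _∨ᵇ_ Preserves₂ _⇒ᵇ_ ⟶ _⇒ᵇ_ ⟶ _⇒ᵇ_
∨-mono {x} {_} {y} f g h with Equivalence.to (T-∨ {x} {y}) h
... | inj₁ tx = T-∨ˡ (f tx)
... | inj₂ ty = T-∨ʳ (g ty)

∧-mono : _∧ᵇ_ Preserves₂ _⇒ᵇ_ ⟶ _⇒ᵇ_ ⟶ _⇒ᵇ_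
∧-mono {x} {x′} {y} {y′} f g h with Equivalence.to (T-∧ {x} {y}) h
... | tx , ty = Equivalence.from (T-∧ {x′} {y′}) (f tx , g ty)

record _≼_ (v w : Val) : Set where
  field
    p≤ : has-p v ⇒ᵇ has-p w
    a≤ : has-a v ⇒ᵇ has-a w
    b≤ : has-b v ⇒ᵇ has-b w
    a⊃b≤ : has-a⊃b v ⇒ᵇ has-a⊃b w
    w₁≤ : has-w₁ v ⇒ᵇ has-w₁ w
    w₂≤ : has-w₂ v ⇒ᵇ has-w₂ w
    *⊤≤ : has-*⊤ v ⇒ᵇ has-*⊤ w
open _≼_

≼-refl : ∀ {v} → v ≼ v
≼-refl = record { p≤ = λ t → t ; a≤ = λ t → t ; b≤ = λ t → t ; a⊃b≤ = λ t → t
                ; w₁≤ = λ t → t ; w₂≤ = λ t → t ; *⊤≤ = λ t → t }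

≼-reflexive : ∀ {v w} → v ≡ w → v ≼ w
≼-reflexive refl = ≼-refl

open Monotone _⇒ᵇ_ ∨-mono ∧-mono

⊗-mono : _⊗_ Preserves₂ _≼_ ⟶ _≼_ ⟶ _≼_
⊗-mono v≤ w≤ = record
  { p≤   = ∨-mono (p≤ v≤) (p≤ w≤)
  ; a≤   = ∨-mono (a≤ v≤) (a≤ w≤)
  ; b≤   = withMP-mono (b≤ v≤) (b≤ w≤) (a≤ v≤) (a≤ w≤) (a⊃b≤ v≤) (a⊃b≤ w≤)
  ; a⊃b≤ = ∨-mono (a⊃b≤ v≤) (a⊃b≤ w≤)
  ; w₁≤  = ∨-mono (w₁≤ v≤) (w₁≤ w≤)
  ; w₂≤  = ∨-mono (w₂≤ v≤) (w₂≤ w≤)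
  ; *⊤≤  = ∨-mono (*⊤≤ v≤) (*⊤≤ w≤)
  }

⊙-mono : _⊙_ Preserves₂ _≼_ ⟶ _≼_ ⟶ _≼_
⊙-mono v≤ w≤ = record
  { p≤   = across-mono (p≤ v≤) (p≤ w≤) (*⊤≤ v≤) (*⊤≤ w≤)
  ; a≤   = withWand-mono (a≤ v≤) (a≤ w≤) (*⊤≤ v≤) (*⊤≤ w≤)
                         (p≤ v≤) (p≤ w≤) (w₁≤ v≤) (w₁≤ w≤)
  ; b≤   = across-mono (b≤ v≤) (b≤ w≤) (*⊤≤ v≤) (*⊤≤ w≤)
  ; a⊃b≤ = withWand-mono (a⊃b≤ v≤) (a⊃b≤ w≤) (*⊤≤ v≤) (*⊤≤ w≤)
                         (p≤ v≤) (p≤ w≤) (w₂≤ v≤) (w₂≤ w≤)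
  ; w₁≤  = across-mono (w₁≤ v≤) (w₁≤ w≤) (*⊤≤ v≤) (*⊤≤ w≤)
  ; w₂≤  = across-mono (w₂≤ v≤) (w₂≤ w≤) (*⊤≤ v≤) (*⊤≤ w≤)
  ; *⊤≤  = ∧-mono (*⊤≤ v≤) (*⊤≤ w≤)
  }

⊗-inflationary : ∀ v w → v ≼ v ⊗ w
⊗-inflationary v w = record
  { p≤ = T-∨ˡ ; a≤ = T-∨ˡ ; b≤ = λ t → T-∨ˡ (T-∨ˡ t) ; a⊃b≤ = T-∨ˡ
  ; w₁≤ = T-∨ˡ ; w₂≤ = T-∨ˡ ; *⊤≤ = T-∨ˡ }

modusPonens : ∀ v → T (has-a v) → v ⊗ atom B ≼ v ⊗ atom A⊃B
modusPonens v ta = record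
  { p≤ = λ t → t ; a≤ = λ t → t
  ; b≤ = λ _ → subst T (sym (withMP-major (has-b v) (has-a v) (has-a⊃b v))) (T-∨ʳ ta)
  ; a⊃b≤ = λ _ → T-∨ʳ tt ; w₁≤ = λ t → t ; w₂≤ = λ t → t ; *⊤≤ = λ t → t }

wandApplication₁ : ∀ v → T (has-p v) → atom A ≼ v ⊙ atom W₁
wandApplication₁ v tp = record
  { p≤ = λ () ; b≤ = λ () ; a⊃b≤ = λ () ; w₁≤ = λ () ; w₂≤ = λ () ; *⊤≤ = λ ()
  ; a≤ = λ _ → subst T (sym (withWand-major (has-a v) (has-*⊤ v) (has-p v) (has-w₁ v))) tp }

wandApplication₂ : ∀ v → T (has-p v) → atom A⊃B ≼ v ⊙ atom W₂
wandApplication₂ v tp = record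
  { p≤ = λ () ; a≤ = λ () ; b≤ = λ () ; w₁≤ = λ () ; w₂≤ = λ () ; *⊤≤ = λ ()
  ; a⊃b≤ = λ _ → subst T (sym (withWand-major (has-a⊃b v) (has-*⊤ v) (has-p v) (has-w₂ v))) tp }

Yields : Val → ∀ {H} → Relevant H → Set
Yields v rel-p   = T (has-p v)
Yields v rel-a   = T (has-a v)
Yields v rel-b   = T (has-b v)
Yields v rel-a⊃b = T (has-a⊃b v ∨ᵇ has-b v)
Yields v rel-w₁  = T (has-w₁ v)
Yields v rel-w₂  = T (has-w₂ v)
Yields v rel-⊤   = Unit
Yields v rel-*⊤  = T (has-*⊤ v)

Yields-mono : ∀ {H v w} (r : Relevant H) → v ≼ w → Yields v r → Yields w r
Yields-mono rel-p   v≤ = p≤ v≤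
Yields-mono rel-a   v≤ = a≤ v≤
Yields-mono rel-b   v≤ = b≤ v≤
Yields-mono rel-a⊃b v≤ = ∨-mono (a⊃b≤ v≤) (b≤ v≤)
Yields-mono rel-w₁  v≤ = w₁≤ v≤
Yields-mono rel-w₂  v≤ = w₂≤ v≤
Yields-mono rel-⊤   v≤ = λ t → t
Yields-mono rel-*⊤  v≤ = *⊤≤ v≤

atom-yields : ∀ {F} (r : Relevant F) → Yields (atom F) r
atom-yields rel-p   = tt
atom-yields rel-a   = tt
atom-yields rel-b   = tt
atom-yields rel-a⊃b = tt
atom-yields rel-w₁  = tt
atom-yields rel-w₂  = tt
atom-yields rel-⊤   = tt
atom-yields rel-*⊤  = tt

implicationIntro : ∀ v → Yields (v ⊗ atom A) rel-b → Yields v rel-a⊃b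
implicationIntro v = subst T (withMP-minor (has-b v) (has-a v) (has-a⊃b v))

wandIntro₁ : ∀ v → Yields (v ⊙ atom P) rel-a → Yields v rel-w₁
wandIntro₁ v = subst T (withWand-minor (has-a v) (has-*⊤ v) (has-p v) (has-w₁ v))

wandIntro₂ : ∀ v → Yields (v ⊙ atom P) rel-a⊃b → Yields v rel-w₂
wandIntro₂ v = subst T (trans
  (cong₂ _∨ᵇ_ (withWand-minor (has-a⊃b v) (has-*⊤ v) (has-p v) (has-w₂ v))
              (across-zeroʳ (has-b v) (has-*⊤ v)))
  (∨-identityʳ (has-w₂ v)))

open Interpretation _⊗_ _⊙_ atom
open Invariance ⊗-comm ⊗-assoc ⊙-comm ⊙-assoc
open Monotonicity _≼_ ≼-refl ⊗-mono ⊙-mono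
open EveryFormula Relevant

-- Replacing a sub-bunch by one of larger value preserves what the whole
-- bunch yields: the common shape of all left and structural rules.
replace : ∀ C {Δ Δ′ H} (r : Relevant H) → ⟦ Δ ⟧ ≼ ⟦ Δ′ ⟧
        → Yields ⟦ C [ Δ ] ⟧ r → Yields ⟦ C [ Δ′ ] ⟧ r
replace C {Δ} {Δ′} r Δ≤Δ′ h =
  subst (λ v → Yields v r) (sym (⟦plug⟧ C Δ′))
    (Yields-mono r (⟦⟧ᶜ-mono C Δ≤Δ′) (subst (λ v → Yields v r) (⟦plug⟧ C Δ) h))

replace-≡ : ∀ C {Δ Δ′ H} (r : Relevant H) → ⟦ Δ ⟧ ≡ ⟦ Δ′ ⟧
          → Yields ⟦ C [ Δ ] ⟧ r → Yields ⟦ C [ Δ′ ] ⟧ r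
replace-≡ C r Δ≡Δ′ = replace C r (≼-reflexive Δ≡Δ′)

-- Left
-- rules on ⊥, ∧, ∨, * and right rules for ∧, ∨, * never apply, since these
-- connectives are not relevant.
sound : ∀ {Γ H} → Γ ⊢[ formulaOnly ] H → Every Γ → (r : Relevant H) → Yields ⟦ Γ ⟧ r
sound (equiv Γ≈Γ′ d) eΓ r = subst (λ v → Yields v r) (sym (⟦⟧-resp-≈ Γ≈Γ′))
  (sound d (Equivalence.to (Every-resp-≈ Γ≈Γ′) eΓ) r)
sound id eΓ r = atom-yields r
sound ⊤R eΓ rel-⊤ = tt
sound *⊤R eΓ rel-*⊤ = tt
sound (⊥L C) eΓ r with splitEvery C _ eΓ
... | _ , ()
sound (∧L C d) eΓ r with splitEvery C _ eΓ
... | _ , ()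
sound (∨L C d e) eΓ r with splitEvery C _ eΓ
... | _ , ()
sound (✶L C d) eΓ r with splitEvery C _ eΓ
... | _ , ()
sound (⊃L {Γ₁ = Γ₁} C d e) eΓ r with splitEvery C _ eΓ
... | eC , (e₁ , rel-a⊃b) = replace C r (modusPonens ⟦ Γ₁ ⟧ (sound d e₁ rel-a))
                                         (sound e (plugEvery C _ eC (e₁ , rel-b)) r)
sound (-✶L {Γ₁ = Γ₁} C d e) eΓ r with splitEvery C _ eΓ
... | eC , (e₁ , rel-w₁) = replace C r (wandApplication₁ ⟦ Γ₁ ⟧ (sound d e₁ rel-p))
                                        (sound e (plugEvery C _ eC rel-a) r)
... | eC , (e₁ , rel-w₂) = replace C r (wandApplication₂ ⟦ Γ₁ ⟧ (sound d e₁ rel-p))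
                                        (sound e (plugEvery C _ eC rel-a⊃b) r)
sound (⊃R {Γ = Γ} d) eΓ rel-a⊃b = implicationIntro ⟦ Γ ⟧ (sound d (eΓ , rel-a) rel-b)
sound (-✶R {Γ = Γ} d) eΓ rel-w₁ = wandIntro₁ ⟦ Γ ⟧ (sound d (eΓ , rel-p) rel-a)
sound (-✶R {Γ = Γ} d) eΓ rel-w₂ = wandIntro₂ ⟦ Γ ⟧ (sound d (eΓ , rel-p) rel-a⊃b)
sound (WkL {Γ₁ = Γ₁} {Γ₂ = Γ₂} C d) eΓ r with splitEvery C _ eΓ
... | eC , (e₁ , _) = replace C r (⊗-inflationary ⟦ Γ₁ ⟧ ⟦ Γ₂ ⟧)
                                  (sound d (plugEvery C _ eC e₁) r)
sound (CtrL C (F , refl) d) eΓ r with splitEvery C _ eΓ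
... | eC , eF = replace-≡ C r (atom-idempotent eF) (sound d (plugEvery C _ eC (eF , eF)) r)
sound (EqAnt₁↓ {Γ₁ = Γ₁} C d) eΓ r with splitEvery C _ eΓ
... | eC , e₁ = replace-≡ C r (⊗-identityʳ ⟦ Γ₁ ⟧) (sound d (plugEvery C _ eC (e₁ , rel-⊤)) r)
sound (EqAnt₁↑ {Γ₁ = Γ₁} C d) eΓ r with splitEvery C _ eΓ
... | eC , (e₁ , _) = replace-≡ C r (sym (⊗-identityʳ ⟦ Γ₁ ⟧)) (sound d (plugEvery C _ eC e₁) r)
sound (EqAnt₂↓ {Γ₁ = Γ₁} C d) eΓ r with splitEvery C _ eΓ
... | eC , e₁ = replace-≡ C r (⊙-identityʳ ⟦ Γ₁ ⟧) (sound d (plugEvery C _ eC (e₁ , rel-*⊤)) r)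
sound (EqAnt₂↑ {Γ₁ = Γ₁} C d) eΓ r with splitEvery C _ eΓ
... | eC , (e₁ , _) = replace-≡ C r (sym (⊙-identityʳ ⟦ Γ₁ ⟧)) (sound d (plugEvery C _ eC e₁) r)

Γ₀ : Bunch
Γ₀ = fm P ,, (fm W₁ ︔ fm W₂)

-- Its value has no b, so b is not derivable with formula contraction.
Γ₀-underivable : ¬ (Γ₀ ⊢[ formulaOnly ] B)
Γ₀-underivable d = sound d (rel-p , rel-w₁ , rel-w₂) rel-b

-- With unrestricted contraction: contract Γ₀ ; Γ₀, keep p -* a in the first
-- copy and p -* (a ⊃ b) in the second, apply both wands, then modus ponens.
Γ₀-derivable : Γ₀ ⊢[ unrestricted ] B
Γ₀-derivable = CtrL hole tt copies
  where
  modusPonensAxiom : (fm A ︔ fm A⊃B) ⊢[ unrestricted ] B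
  modusPonensAxiom = ⊃L {Γ₁ = fm A} hole id (equiv ︔-comm (WkL {Γ₁ = fm B} hole id))

  bothWands : ((fm P ,, fm W₁) ︔ (fm P ,, fm W₂)) ⊢[ unrestricted ] B
  bothWands = -✶L {Γ₁ = fm P} (hole ︔ˡ (fm P ,, fm W₂)) id
                (-✶L {Γ₁ = fm P} (fm A ︔ʳ hole) id modusPonensAxiom)

  secondCopyWeakened : ((fm P ,, fm W₁) ︔ Γ₀) ⊢[ unrestricted ] B
  secondCopyWeakened = equiv (︔-cong ≈-refl (,-cong ≈-refl ︔-comm))
    (WkL {Γ₁ = fm W₂} {Γ₂ = fm W₁} ((fm P ,, fm W₁) ︔ʳ (fm P ,ʳ hole)) bothWands)

  copies : (Γ₀ ︔ Γ₀) ⊢[ unrestricted ] B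
  copies = WkL {Γ₁ = fm W₁} {Γ₂ = fm W₂} ((fm P ,ʳ hole) ︔ˡ Γ₀) secondCopyWeakened

mainTheorem9 : Σ Bunch (λ Γ → Σ Formula (λ F →
                 (Γ ⊢[ unrestricted ] F) × ¬ (Γ ⊢[ formulaOnly ] F)))
mainTheorem9 = Γ₀ , B , Γ₀-derivable , Γ₀-underivable
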